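{- Let $U$ be a Niemeier lattice, $\Upsilon=\frac1{\sqrt2}U$, and let $M,N$ be a polarization of $\Upsilon$ such that $M$ and $N$ are each isometric to Niemeier lattices. Let $L=L(M,N,3)$ (a lattice of rank 72). Then: (i) $\mu(L)\ge4$; (ii) if $M$ is not isometric to the Leech lattice $\Lambda$, then $\mu(L)=4$; (iii) if $U\cong M\cong\Lambda$, then $\mu(L)\ge6$; (iv) if $U\cong M\cong \Lambda$ and $N\not\cong\Lambda$, then $\mu(L)=6$.
   Context: All lattices are positive definite rational lattices; $\mu(X)=\min\{(x,x):x\in X,x\ne0\}$. A Niemeier lattice is an even integral unimodular lattice of rank 24; the Leech lattice $\Lambda$ is the (unique up to isometry) Niemeier lattice with no vectors of norm 2. For $U$ even unimodular and $\Upsilon=\frac1{\sqrt2}U$, a polarization of $\Upsilon$ is a pair of integral sublattices $M,N\subseteq\Upsilon$ with $M+N=\Upsilon$ and $M\cap N=2\Upsilon$. Inside the orthogonal direct sum $\Upsilon^3$, $L(M,N,3)=L_M+L^N$ where $L_M=\{(x_1,x_2,x_3)\in M^3: x_1+x_2+x_3\in M\cap N\}$ and $L^N=\{(y,y,y):y\in N\}$. -}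

module Defs where

open import Data.Nat using (ℕ; zero; suc)
open import Data.Integer using (ℤ; +_)
import Data.Integer as ℤ
open import Data.Rational using (ℚ; _+_; _*_; _/_; 0ℚ; ½; _≤_; _<_)
open import Data.Fin using (Fin; zero; suc)
open import Data.Product using (Σ; _×_; _,_; ∃; ∃-syntax; Σ-syntax)
open import Relation.Binary.PropositionalEquality using (_≡_)
open import Relation.Nullary using (¬_)

Vec : ℕ → Set
Vec n = Fin n → ℚ

ΣFin : ∀ n → (Fin n → ℚ) → ℚ
ΣFin zero    f = 0ℚ
ΣFin (suc n) f = f zero + ΣFin n (λ i → f (suc i))

_⊕_ : ∀ {n} → Vec n → Vec n → Vec n
(x ⊕ y) i = x i + y i

zeroV : ∀ {n} → Vec n
zeroV _ = 0ℚ

_·_ : ∀ {n} → ℤ → Vec n → Vec n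
(c · x) i = (c / 1) * x i

_≈_ : ∀ {n} → Vec n → Vec n → Set
x ≈ y = ∀ i → x i ≡ y i

NonZeroV : ∀ {n} → Vec n → Set
NonZeroV x = ¬ (x ≈ zeroV)

Gram : ℕ → Set
Gram n = Fin n → Fin n → ℚ

Symmetric : ∀ {n} → Gram n → Set
Symmetric G = ∀ i j → G i j ≡ G j i

bil : ∀ {n} → Gram n → Vec n → Vec n → ℚ
bil {n} G x y = ΣFin n (λ i → ΣFin n (λ j → x i * (G i j * y j)))

-- the form scaled by 1/2: this is the Gram matrix of  (1/√2)·U
half : ∀ {n} → Gram n → Gram n
half G i j = ½ * G i j

IsInt : ℚ → Set
IsInt q = ∃[ z ] q ≡ z / 1

IsEven : ℚ → Set
IsEven q = ∃[ z ] q ≡ (+ 2 ℤ.* z) / 1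

Span : ∀ {n} k → (Fin k → Vec n) → Vec n → Set
Span {n} k g x = Σ[ c ∈ (Fin k → ℤ) ] (∀ i → x i ≡ ΣFin k (λ a → (c a / 1) * g a i))

-- A lattice in the quadratic space (ℚ²⁴, G) (given as a subset) is a
-- Niemeier lattice: positive definite, even (hence integral), unimodular
-- (L equals its dual L# = {x ∈ ℚ²⁴ : (x,L) ⊆ ℤ}; this forces rank 24).
IsNiemeier : Gram 24 → (Vec 24 → Set) → Set
IsNiemeier G L =
    (∀ x → L x → NonZeroV x → 0ℚ < bil G x x)
  × (∀ x y → L x → L y → IsInt (bil G x y))
  × (∀ x → L x → IsEven (bil G x x))
  × (∀ x → (∀ y → L y → IsInt (bil G x y)) → L x)

-- Leech lattice: the Niemeier lattice with no vectors of norm 2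
-- (unique up to isometry, so "isometric to Λ" is this predicate).
IsLeech : Gram 24 → (Vec 24 → Set) → Set
IsLeech G L = IsNiemeier G L × (∀ x → L x → ¬ (bil G x x ≡ + 2 / 1))

-- Polarizations of Υ (Υ has the same underlying set as U, form halved)

_⊆_ : ∀ {n} → (Vec n → Set) → (Vec n → Set) → Set
A ⊆ B = ∀ x → A x → B x

IsPolarization : Gram 24 → (Υ M N : Vec 24 → Set) → Set
IsPolarization H Υ M N =
    M ⊆ Υ × N ⊆ Υ
  × (∀ x y → M x → M y → IsInt (bil H x y))
  × (∀ x y → N x → N y → IsInt (bil H x y))
  × (∀ u → Υ u → ∃[ m ] ∃[ v ] (M m × N v × u ≈ (m ⊕ v)))
  -- M ∩ N = 2Υ
  × (∀ x → (M x × N x) → ∃[ u ] (Υ u × x ≈ ((+ 2) · u)))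
  × (∀ u → Υ u → M ((+ 2) · u) × N ((+ 2) · u))

V3 : Set
V3 = Vec 24 × Vec 24 × Vec 24

_⊕₃_ : V3 → V3 → V3
(a₁ , a₂ , a₃) ⊕₃ (b₁ , b₂ , b₃) = (a₁ ⊕ b₁) , (a₂ ⊕ b₂) , (a₃ ⊕ b₃)

_≈₃_ : V3 → V3 → Set
(a₁ , a₂ , a₃) ≈₃ (b₁ , b₂ , b₃) = a₁ ≈ b₁ × a₂ ≈ b₂ × a₃ ≈ b₃

NonZero₃ : V3 → Set
NonZero₃ (x₁ , x₂ , x₃) = ¬ (x₁ ≈ zeroV × x₂ ≈ zeroV × x₃ ≈ zeroV)

norm₃ : Gram 24 → V3 → ℚ
norm₃ H (x₁ , x₂ , x₃) = bil H x₁ x₁ + (bil H x₂ x₂ + bil H x₃ x₃)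

L-lower : (M N : Vec 24 → Set) → V3 → Set
L-lower M N (x₁ , x₂ , x₃) = M x₁ × M x₂ × M x₃ × M s × N s
  where s = x₁ ⊕ (x₂ ⊕ x₃)

L-upper : (N : Vec 24 → Set) → V3 → Set
L-upper N x = ∃[ y ] (N y × x ≈₃ (y , y , y))

L3 : (M N : Vec 24 → Set) → V3 → Set
L3 M N x = ∃[ a ] ∃[ b ] (L-lower M N a × L-upper N b × x ≈₃ (a ⊕₃ b))

MinGE : (V3 → Set) → (V3 → ℚ) → ℚ → Set
MinGE X Q c = ∀ x → X x → NonZero₃ x → c ≤ Q x

MinEq : (V3 → Set) → (V3 → ℚ) → ℚ → Set
MinEq X Q c = MinGE X Q c × ∃[ x ] (X x × NonZero₃ x × Q x ≡ c)

-- Write x ∈ L(M,N,3) as xᵢ = aᵢ + y with aᵢ ∈ M, y ∈ N and a₁ + a₂ + a₃ ∈ N.  Then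
-- norm x = Σ (aᵢ,aᵢ) + 2 (Σ aᵢ, y) + 3 (y,y) is even.  If some xᵢ vanishes then y ∈ M, so
-- the remaining coordinates lie in M: two nonzero ones have norm at least μ(M) each, and a
-- single nonzero one lies in M ∩ N = 2U, so its norm is 4 times a nonzero Υ-norm.  If no xᵢ
-- vanishes, the xᵢ are nonzero vectors of U, of Υ-norm at least 1 (at least 2 if U ≅ Λ), and
-- evenness turns the bound 3 into 4.  A vector of norm 2 in M gives (m, −m, 0) of norm 4, and
-- one in N gives (n, n, n) of norm 6.  Such vectors are found by a finite search: positive
-- definiteness (completing squares) bounds the coordinates of vectors of norm 2, and the
-- generators bound their denominators.

module Submission where

open import Defs
open import Data.Nat as ℕ using (ℕ; zero; suc; s≤s; z≤n)
import Data.Nat.Properties as ℕP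
open import Data.Nat.Divisibility using (_∣_; divides; ∣-trans)
open import Data.Nat.ListAction using (product)
open import Data.Nat.ListAction.Properties using (∈⇒∣product; product≢0)
open import Data.Integer as ℤ using (ℤ; +_; -[1+_]; +≤+; +<+)
import Data.Integer.Properties as ℤP
open import Data.Rational as ℚ
  using (ℚ; mkℚ; _+_; _*_; _/_; 0ℚ; 1ℚ; ½; _≤_; _<_; ↥_; ↧ₙ_; -_; 1/_; ∣_∣)
open import Data.Rational.Literals using (fromℤ)
import Data.Rational.Properties as ℚP
import Data.Rational.Solver as ℚSolver
import Data.Rational.Unnormalised as ℚᵘ
import Data.Rational.Unnormalised.Properties as ℚᵘP
open import Data.Fin using (Fin; zero; suc)
open import Data.Fin.Properties using (all?)
open import Data.List as List using (List; []; _∷_)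
open import Data.List.Membership.Propositional using (_∈_; find; lose)
open import Data.List.Membership.Propositional.Properties using (∈-tabulate⁺)
open import Data.List.Relation.Unary.Any using (Any; here; there; any?)
import Data.List.Relation.Unary.All.Properties as All
open import Data.Product using (_×_; _,_; ∃; ∃-syntax; proj₁; proj₂)
open import Data.Sum using (inj₁; inj₂)
open import Data.Empty using (⊥-elim)
open import Function using (_∘_)
open import Relation.Binary.PropositionalEquality
open import Relation.Nullary using (¬_; Dec; yes; no)
open import Relation.Nullary.Decidable using (map′; _×-dec_)

/1≡fromℤ : ∀ z → z / 1 ≡ fromℤ z
/1≡fromℤ z = ℚP.↥p/↧p≡p (fromℤ z)

fromℤ-homo-+ : ∀ a b → fromℤ a + fromℤ b ≡ fromℤ (a ℤ.+ b)
fromℤ-homo-+ a b =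
  trans (cong₂ (λ u v → (u ℤ.+ v) / 1) (ℤP.*-identityʳ a) (ℤP.*-identityʳ b)) (/1≡fromℤ (a ℤ.+ b))

fromℤ-homo-* : ∀ a b → fromℤ a * fromℤ b ≡ fromℤ (a ℤ.* b)
fromℤ-homo-* a b = /1≡fromℤ (a ℤ.* b)

fromℤ-mono-≤ : ∀ {a b} → a ℤ.≤ b → fromℤ a ≤ fromℤ b
fromℤ-mono-≤ {a} {b} a≤b = ℚ.*≤* (subst₂ ℤ._≤_ (sym (ℤP.*-identityʳ a)) (sym (ℤP.*-identityʳ b)) a≤b)

fromℤ-cancel-≤ : ∀ {a b} → fromℤ a ≤ fromℤ b → a ℤ.≤ b
fromℤ-cancel-≤ {a} {b} (ℚ.*≤* a≤b) = subst₂ ℤ._≤_ (ℤP.*-identityʳ a) (ℤP.*-identityʳ b) a≤b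

fromℤ-cancel-< : ∀ {a b} → fromℤ a < fromℤ b → a ℤ.< b
fromℤ-cancel-< {a} {b} (ℚ.*<* a<b) = subst₂ ℤ._<_ (ℤP.*-identityʳ a) (ℤP.*-identityʳ b) a<b

IsInt⇒≡fromℤ : ∀ {q} → IsInt q → ∃[ z ] q ≡ fromℤ z
IsInt⇒≡fromℤ (z , q≡z) = z , trans q≡z (/1≡fromℤ z)

IsInt-fromℤ : ∀ z → IsInt (fromℤ z)
IsInt-fromℤ z = z , sym (/1≡fromℤ z)

IsInt-+ : ∀ {p q} → IsInt p → IsInt q → IsInt (p + q)
IsInt-+ p∈ℤ q∈ℤ with IsInt⇒≡fromℤ p∈ℤ | IsInt⇒≡fromℤ q∈ℤ
... | a , refl | b , refl = subst IsInt (sym (fromℤ-homo-+ a b)) (IsInt-fromℤ (a ℤ.+ b))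

IsInt-* : ∀ {p q} → IsInt p → IsInt q → IsInt (p * q)
IsInt-* p∈ℤ q∈ℤ with IsInt⇒≡fromℤ p∈ℤ | IsInt⇒≡fromℤ q∈ℤ
... | a , refl | b , refl = subst IsInt (sym (fromℤ-homo-* a b)) (IsInt-fromℤ (a ℤ.* b))

IsInt? : ∀ q → Dec (IsInt q)
IsInt? (mkℚ n zero _)    = yes (IsInt-fromℤ n)
IsInt? (mkℚ n (suc d) _) = no λ q∈ℤ → ℕP.1+n≢0 (ℕP.suc-injective (cong ↧ₙ_ (proj₂ (IsInt⇒≡fromℤ q∈ℤ))))

IsEven⇒≡fromℤ : ∀ {q} → IsEven q → ∃[ K ] q ≡ fromℤ (+ 2 ℤ.* K)
IsEven⇒≡fromℤ (K , q≡2K) = K , trans q≡2K (/1≡fromℤ (+ 2 ℤ.* K))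

IsEven-+ : ∀ {p q} → IsEven p → IsEven q → IsEven (p + q)
IsEven-+ p∈2ℤ q∈2ℤ with IsEven⇒≡fromℤ p∈2ℤ | IsEven⇒≡fromℤ q∈2ℤ
... | a , refl | b , refl = a ℤ.+ b , (begin
  fromℤ (+ 2 ℤ.* a) + fromℤ (+ 2 ℤ.* b)  ≡⟨ fromℤ-homo-+ (+ 2 ℤ.* a) (+ 2 ℤ.* b) ⟩
  fromℤ (+ 2 ℤ.* a ℤ.+ + 2 ℤ.* b)        ≡⟨ cong fromℤ (sym (ℤP.*-distribˡ-+ (+ 2) a b)) ⟩
  fromℤ (+ 2 ℤ.* (a ℤ.+ b))              ≡⟨ sym (/1≡fromℤ _) ⟩
  (+ 2 ℤ.* (a ℤ.+ b)) / 1                ∎)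
  where open ≡-Reasoning

ℤ*-left-comm : ∀ a b c → a ℤ.* (b ℤ.* c) ≡ b ℤ.* (a ℤ.* c)
ℤ*-left-comm a b c =
  trans (sym (ℤP.*-assoc a b c)) (trans (cong (ℤ._* c) (ℤP.*-comm a b)) (ℤP.*-assoc b a c))

IsEven-* : ∀ {p q} → IsInt p → IsEven q → IsEven (p * q)
IsEven-* p∈ℤ q∈2ℤ with IsInt⇒≡fromℤ p∈ℤ | IsEven⇒≡fromℤ q∈2ℤ
... | a , refl | b , refl = a ℤ.* b , (begin
  fromℤ a * fromℤ (+ 2 ℤ.* b)  ≡⟨ fromℤ-homo-* a (+ 2 ℤ.* b) ⟩
  fromℤ (a ℤ.* (+ 2 ℤ.* b))    ≡⟨ cong fromℤ (ℤ*-left-comm a (+ 2) b) ⟩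
  fromℤ (+ 2 ℤ.* (a ℤ.* b))    ≡⟨ sym (/1≡fromℤ _) ⟩
  (+ 2 ℤ.* (a ℤ.* b)) / 1      ∎)
  where open ≡-Reasoning

IsEven-2* : ∀ {q} → IsInt q → IsEven (fromℤ (+ 2) * q)
IsEven-2* q∈ℤ with IsInt⇒≡fromℤ q∈ℤ
... | a , refl = a , trans (fromℤ-homo-* (+ 2) a) (sym (/1≡fromℤ _))

ΣFin-cong : ∀ n {f g : Fin n → ℚ} → (∀ i → f i ≡ g i) → ΣFin n f ≡ ΣFin n g
ΣFin-cong zero    f≗g = refl
ΣFin-cong (suc n) f≗g = cong₂ _+_ (f≗g zero) (ΣFin-cong n (f≗g ∘ suc))

ΣFin-0 : ∀ n → ΣFin n (λ _ → 0ℚ) ≡ 0ℚ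
ΣFin-0 zero    = refl
ΣFin-0 (suc n) = cong (_+_ 0ℚ) (ΣFin-0 n)

ΣFin-+ : ∀ n (f g : Fin n → ℚ) → ΣFin n (λ i → f i + g i) ≡ ΣFin n f + ΣFin n g
ΣFin-+ zero    f g = refl
ΣFin-+ (suc n) f g =
  trans (cong (_+_ (f zero + g zero)) (ΣFin-+ n (f ∘ suc) (g ∘ suc)))
        (interchange (f zero) (g zero) (ΣFin n (f ∘ suc)) (ΣFin n (g ∘ suc)))
  where
  open ℚSolver.+-*-Solver
  interchange : ∀ a b c d → (a + b) + (c + d) ≡ (a + c) + (b + d)
  interchange = solve 4 (λ a b c d → (a :+ b) :+ (c :+ d) := (a :+ c) :+ (b :+ d)) refl

*-distribˡ-ΣFin : ∀ n (c : ℚ) (f : Fin n → ℚ) → c * ΣFin n f ≡ ΣFin n (λ i → c * f i)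
*-distribˡ-ΣFin zero    c f = ℚP.*-zeroʳ c
*-distribˡ-ΣFin (suc n) c f =
  trans (ℚP.*-distribˡ-+ c (f zero) _) (cong (_+_ (c * f zero)) (*-distribˡ-ΣFin n c (f ∘ suc)))

ΣFin-swap : ∀ n m (f : Fin n → Fin m → ℚ) →
            ΣFin n (λ i → ΣFin m (f i)) ≡ ΣFin m (λ j → ΣFin n (λ i → f i j))
ΣFin-swap zero    m f = sym (ΣFin-0 m)
ΣFin-swap (suc n) m f =
  trans (cong (_+_ (ΣFin m (f zero))) (ΣFin-swap n m (f ∘ suc)))
        (sym (ΣFin-+ m (f zero) (λ j → ΣFin n (λ i → f (suc i) j))))

ΣFin-IsInt : ∀ n (f : Fin n → ℚ) → (∀ i → IsInt (f i)) → IsInt (ΣFin n f)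
ΣFin-IsInt zero    f f∈ℤ = IsInt-fromℤ (+ 0)
ΣFin-IsInt (suc n) f f∈ℤ = IsInt-+ (f∈ℤ zero) (ΣFin-IsInt n (f ∘ suc) (f∈ℤ ∘ suc))

ΣFin-nonNeg : ∀ n (f : Fin n → ℚ) → (∀ i → 0ℚ ≤ f i) → 0ℚ ≤ ΣFin n f
ΣFin-nonNeg zero    f f≥0 = ℚP.≤-refl
ΣFin-nonNeg (suc n) f f≥0 = ℚP.+-mono-≤ (f≥0 zero) (ΣFin-nonNeg n (f ∘ suc) (f≥0 ∘ suc))

∣ΣFin∣≤ΣFin∣∣ : ∀ n (f : Fin n → ℚ) → ∣ ΣFin n f ∣ ≤ ΣFin n (λ i → ∣ f i ∣)
∣ΣFin∣≤ΣFin∣∣ zero    f = ℚP.≤-refl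
∣ΣFin∣≤ΣFin∣∣ (suc n) f =
  ℚP.≤-trans (ℚP.∣p+q∣≤∣p∣+∣q∣ (f zero) _) (ℚP.+-monoʳ-≤ ∣ f zero ∣ (∣ΣFin∣≤ΣFin∣∣ n (f ∘ suc)))

ΣFin-mono-≤ : ∀ n {f g : Fin n → ℚ} → (∀ i → f i ≤ g i) → ΣFin n f ≤ ΣFin n g
ΣFin-mono-≤ zero    f≤g = ℚP.≤-refl
ΣFin-mono-≤ (suc n) f≤g = ℚP.+-mono-≤ (f≤g zero) (ΣFin-mono-≤ n (f≤g ∘ suc))

ΣFin-square : ∀ n (f : Fin n → ℚ) → ΣFin n (λ i → ΣFin n (λ j → f i * f j)) ≡ ΣFin n f * ΣFin n f
ΣFin-square n f = begin
  ΣFin n (λ i → ΣFin n (λ j → f i * f j))  ≡⟨ ΣFin-cong n (λ i → sym (*-distribˡ-ΣFin n (f i) f)) ⟩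
  ΣFin n (λ i → f i * ΣFin n f)            ≡⟨ ΣFin-cong n (λ i → ℚP.*-comm (f i) (ΣFin n f)) ⟩
  ΣFin n (λ i → ΣFin n f * f i)            ≡⟨ sym (*-distribˡ-ΣFin n (ΣFin n f) f) ⟩
  ΣFin n f * ΣFin n f                      ∎
  where open ≡-Reasoning

δ : ∀ {k} → Fin k → Fin k → ℤ
δ zero    zero    = + 1
δ zero    (suc b) = + 0
δ (suc a) zero    = + 0
δ (suc a) (suc b) = δ a b

ΣFin-δ : ∀ k (a : Fin k) (f : Fin k → ℚ) → ΣFin k (λ b → (δ a b / 1) * f b) ≡ f a
ΣFin-δ (suc k) zero f =
  trans (cong₂ _+_ (ℚP.*-identityˡ (f zero))
                   (trans (ΣFin-cong k (λ b → ℚP.*-zeroˡ (f (suc b)))) (ΣFin-0 k)))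
        (ℚP.+-identityʳ (f zero))
ΣFin-δ (suc k) (suc a) f =
  trans (cong₂ _+_ (ℚP.*-zeroˡ (f zero)) (ΣFin-δ k a (f ∘ suc))) (ℚP.+-identityˡ (f (suc a)))

module _ {n : ℕ} (G : Gram n) where

  bil-cong : ∀ {x x′ y y′ : Vec n} → x ≈ x′ → y ≈ y′ → bil G x y ≡ bil G x′ y′
  bil-cong x≈x′ y≈y′ =
    ΣFin-cong n (λ i → ΣFin-cong n (λ j → cong₂ (λ u v → u * (G i j * v)) (x≈x′ i) (y≈y′ j)))

  bil-+ˡ : ∀ (x y z : Vec n) → bil G (x ⊕ y) z ≡ bil G x z + bil G y z
  bil-+ˡ x y z = trans
    (ΣFin-cong n (λ i → trans (ΣFin-cong n (λ j → ℚP.*-distribʳ-+ (G i j * z j) (x i) (y i)))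
                              (ΣFin-+ n _ _)))
    (ΣFin-+ n _ _)

  bil-+ʳ : ∀ (x y z : Vec n) → bil G x (y ⊕ z) ≡ bil G x y + bil G x z
  bil-+ʳ x y z = trans
    (ΣFin-cong n (λ i → trans (ΣFin-cong n (λ j → distrib (x i) (G i j) (y j) (z j))) (ΣFin-+ n _ _)))
    (ΣFin-+ n _ _)
    where
    open ℚSolver.+-*-Solver
    distrib : ∀ a b c d → a * (b * (c + d)) ≡ a * (b * c) + a * (b * d)
    distrib = solve 4 (λ a b c d → a :* (b :* (c :+ d)) := a :* (b :* c) :+ a :* (b :* d)) refl

  bil-·ˡ : ∀ (c : ℤ) (x y : Vec n) → bil G (c · x) y ≡ (c / 1) * bil G x y
  bil-·ˡ c x y = sym (trans (*-distribˡ-ΣFin n (c / 1) _) (ΣFin-cong n (λ i →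
    trans (*-distribˡ-ΣFin n (c / 1) _) (ΣFin-cong n (λ j → sym (ℚP.*-assoc (c / 1) (x i) _))))))

  bil-·ʳ : ∀ (c : ℤ) (x y : Vec n) → bil G x (c · y) ≡ (c / 1) * bil G x y
  bil-·ʳ c x y = sym (trans (*-distribˡ-ΣFin n (c / 1) _) (ΣFin-cong n (λ i →
    trans (*-distribˡ-ΣFin n (c / 1) _) (ΣFin-cong n (λ j → pull (c / 1) (x i) (G i j) (y j))))))
    where
    open ℚSolver.+-*-Solver
    pull : ∀ k a b d → k * (a * (b * d)) ≡ a * (b * (k * d))
    pull = solve 4 (λ k a b d → k :* (a :* (b :* d)) := a :* (b :* (k :* d))) refl

  bil-sym : Symmetric G → ∀ (x y : Vec n) → bil G x y ≡ bil G y x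
  bil-sym G-sym x y = trans (ΣFin-swap n n _) (ΣFin-cong n (λ j → ΣFin-cong n (λ i →
    trans (cong (λ t → x i * (t * y j)) (G-sym i j)) (swap (x i) (G j i) (y j)))))
    where
    open ℚSolver.+-*-Solver
    swap : ∀ a b d → a * (b * d) ≡ d * (b * a)
    swap = solve 3 (λ a b d → a :* (b :* d) := d :* (b :* a)) refl

  bil-zeroˡ : ∀ {x : Vec n} (y : Vec n) → x ≈ zeroV → bil G x y ≡ 0ℚ
  bil-zeroˡ {x} y x≈0 = trans (bil-cong x≈0 (λ _ → refl))
    (trans (ΣFin-cong n (λ i → trans (ΣFin-cong n (λ j → ℚP.*-zeroˡ (G i j * y j))) (ΣFin-0 n))) (ΣFin-0 n))

  bil-ΣFinˡ : ∀ k (h : Fin k → Vec n) {x : Vec n} (y : Vec n) → (∀ i → x i ≡ ΣFin k (λ a → h a i)) →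
              bil G x y ≡ ΣFin k (λ a → bil G (h a) y)
  bil-ΣFinˡ zero    h y x≈0 = bil-zeroˡ y x≈0
  bil-ΣFinˡ (suc k) h y x≈Σh =
    trans (bil-cong x≈Σh (λ _ → refl))
          (trans (bil-+ˡ (h zero) _ y) (cong (_+_ (bil G (h zero) y)) (bil-ΣFinˡ k (h ∘ suc) y (λ _ → refl))))

  bil-expand : Symmetric G → ∀ (a y : Vec n) →
               bil G (a ⊕ y) (a ⊕ y) ≡ bil G a a + (fromℤ (+ 2) * bil G a y + bil G y y)
  bil-expand G-sym a y = begin
    bil G (a ⊕ y) (a ⊕ y)                              ≡⟨ bil-+ˡ a y (a ⊕ y) ⟩
    bil G a (a ⊕ y) + bil G y (a ⊕ y)                  ≡⟨ cong₂ _+_ (bil-+ʳ a a y) (bil-+ʳ y a y) ⟩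
    (bil G a a + bil G a y) + (bil G y a + bil G y y)  ≡⟨ cong (λ t → (bil G a a + bil G a y) + (t + bil G y y))
                                                               (bil-sym G-sym y a) ⟩
    (bil G a a + bil G a y) + (bil G a y + bil G y y)  ≡⟨ collect (bil G a a) (bil G a y) (bil G y y) ⟩
    bil G a a + (fromℤ (+ 2) * bil G a y + bil G y y)  ∎
    where
    open ≡-Reasoning
    open ℚSolver.+-*-Solver
    collect : ∀ p q r → (p + q) + (q + r) ≡ p + (fromℤ (+ 2) * q + r)
    collect = solve 3 (λ p q r → (p :+ q) :+ (q :+ r) := p :+ (con (fromℤ (+ 2)) :* q :+ r)) refl

bil-half : ∀ {n} (G : Gram n) (x y : Vec n) → bil (half G) x y ≡ ½ * bil G x y
bil-half {n} G x y = sym (trans (*-distribˡ-ΣFin n ½ _) (ΣFin-cong n (λ i →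
  trans (*-distribˡ-ΣFin n ½ _) (ΣFin-cong n (λ j → pull ½ (x i) (G i j) (y j))))))
  where
  open ℚSolver.+-*-Solver
  pull : ∀ h a b d → h * (a * (b * d)) ≡ a * ((h * b) * d)
  pull = solve 4 (λ h a b d → h :* (a :* (b :* d)) := a :* ((h :* b) :* d)) refl

half-symmetric : ∀ {n} {G : Gram n} → Symmetric G → Symmetric (half G)
half-symmetric G-sym i j = cong (½ *_) (G-sym i j)

⊕-identityʳ : ∀ {n} {v w : Vec n} → w ≈ zeroV → (v ⊕ w) ≈ v
⊕-identityʳ {v = v} w≈0 j = trans (cong (_+_ (v j)) (w≈0 j)) (ℚP.+-identityʳ (v j))

⊕-identityˡ : ∀ {n} {v w : Vec n} → v ≈ zeroV → (v ⊕ w) ≈ w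
⊕-identityˡ {w = w} v≈0 j = trans (cong (_+ w j) (v≈0 j)) (ℚP.+-identityˡ (w j))

module _ {n k : ℕ} (g : Fin k → Vec n) where

  Span-resp : ∀ {x y} → x ≈ y → Span k g x → Span k g y
  Span-resp x≈y (c , x≡Σ) = c , λ i → trans (sym (x≈y i)) (x≡Σ i)

  Span-+ : ∀ {x y} → Span k g x → Span k g y → Span k g (x ⊕ y)
  Span-+ {x} {y} (c , x≡Σ) (d , y≡Σ) = (λ a → c a ℤ.+ d a) , λ i → begin
    x i + y i                                                        ≡⟨ cong₂ _+_ (x≡Σ i) (y≡Σ i) ⟩
    ΣFin k (λ a → (c a / 1) * g a i) + ΣFin k (λ a → (d a / 1) * g a i) ≡⟨ sym (ΣFin-+ k _ _) ⟩
    ΣFin k (λ a → (c a / 1) * g a i + (d a / 1) * g a i)             ≡⟨ ΣFin-cong k (λ a → sym (coeff a i)) ⟩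
    ΣFin k (λ a → ((c a ℤ.+ d a) / 1) * g a i)                       ∎
    where
    open ≡-Reasoning
    coeff : ∀ a i → ((c a ℤ.+ d a) / 1) * g a i ≡ (c a / 1) * g a i + (d a / 1) * g a i
    coeff a i = begin
      ((c a ℤ.+ d a) / 1) * g a i                 ≡⟨ cong (_* g a i) (trans (/1≡fromℤ _) (sym (fromℤ-homo-+ (c a) (d a)))) ⟩
      (fromℤ (c a) + fromℤ (d a)) * g a i         ≡⟨ ℚP.*-distribʳ-+ (g a i) (fromℤ (c a)) (fromℤ (d a)) ⟩
      fromℤ (c a) * g a i + fromℤ (d a) * g a i   ≡⟨ sym (cong₂ (λ u v → u * g a i + v * g a i) (/1≡fromℤ (c a)) (/1≡fromℤ (d a))) ⟩
      (c a / 1) * g a i + (d a / 1) * g a i       ∎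

  Span-· : ∀ (z : ℤ) {x} → Span k g x → Span k g (z · x)
  Span-· z {x} (c , x≡Σ) = (λ a → z ℤ.* c a) , λ i → begin
    (z / 1) * x i                                  ≡⟨ cong ((z / 1) *_) (x≡Σ i) ⟩
    (z / 1) * ΣFin k (λ a → (c a / 1) * g a i)     ≡⟨ *-distribˡ-ΣFin k (z / 1) _ ⟩
    ΣFin k (λ a → (z / 1) * ((c a / 1) * g a i))   ≡⟨ ΣFin-cong k (λ a → sym (ℚP.*-assoc (z / 1) (c a / 1) (g a i))) ⟩
    ΣFin k (λ a → ((z / 1) * (c a / 1)) * g a i)   ≡⟨ ΣFin-cong k (λ a → cong (_* g a i) (coeff a)) ⟩
    ΣFin k (λ a → ((z ℤ.* c a) / 1) * g a i)       ∎
    where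
    open ≡-Reasoning
    coeff : ∀ a → (z / 1) * (c a / 1) ≡ (z ℤ.* c a) / 1
    coeff a = trans (cong₂ _*_ (/1≡fromℤ z) (/1≡fromℤ (c a)))
                    (trans (fromℤ-homo-* z (c a)) (sym (/1≡fromℤ _)))

  Span-0 : ∀ {x} → x ≈ zeroV → Span k g x
  Span-0 x≈0 = (λ _ → + 0) , λ i → trans (x≈0 i) (sym (trans (ΣFin-cong k (λ a → ℚP.*-zeroˡ (g a i))) (ΣFin-0 k)))

  Span-generator : ∀ a → Span k g (g a)
  Span-generator a = δ a , λ i → sym (ΣFin-δ k a (λ b → g b i))

  Span-≈+ : ∀ {a y x} → x ≈ (a ⊕ y) → Span k g a → Span k g y → Span k g x
  Span-≈+ x≈a+y a∈L y∈L = Span-resp (λ j → sym (x≈a+y j)) (Span-+ a∈L y∈L)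

  Span-⊕-cancelˡ : ∀ {a y x} → x ≈ (a ⊕ y) → x ≈ zeroV → Span k g a → Span k g y
  Span-⊕-cancelˡ {a} {y} x≈a+y x≈0 a∈L = Span-resp y≡-a (Span-· -[1+ 0 ] a∈L)
    where
    open ℚSolver.+-*-Solver
    y≡-a : ∀ j → ((-[1+ 0 ]) · a) j ≡ y j
    y≡-a j = sym (trans (solve 2 (λ p q → q := (p :+ q) :+ con (-[1+ 0 ] / 1) :* p) refl (a j) (y j))
                 (trans (cong (_+ (-[1+ 0 ] / 1) * a j) (trans (sym (x≈a+y j)) (x≈0 j))) (ℚP.+-identityˡ _)))

-- Positive definite forms

PosDef : ∀ {n} → Gram n → Set
PosDef {n} G = ∀ (x : Vec n) → NonZeroV x → 0ℚ < bil G x x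

≈zeroV? : ∀ {n} (x : Vec n) → Dec (x ≈ zeroV)
≈zeroV? x = all? (λ i → x i ℚP.≟ 0ℚ)

PosDef⇒nonNeg : ∀ {n} {G : Gram n} → PosDef G → ∀ x → 0ℚ ≤ bil G x x
PosDef⇒nonNeg {G = G} G>0 x with ≈zeroV? x
... | yes x≈0 = ℚP.≤-reflexive (sym (bil-zeroˡ G x x≈0))
... | no  x≉0 = ℚP.<⇒≤ (G>0 x x≉0)

*-monoˡ-≤-0≤ : ∀ {r p q} → 0ℚ ≤ r → p ≤ q → r * p ≤ r * q
*-monoˡ-≤-0≤ {r} 0≤r = ℚP.*-monoˡ-≤-nonNeg r {{ℚ.nonNegative 0≤r}}

0≤* : ∀ {p q} → 0ℚ ≤ p → 0ℚ ≤ q → 0ℚ ≤ p * q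
0≤* {p} 0≤p 0≤q = subst (_≤ p * _) (ℚP.*-zeroʳ p) (*-monoˡ-≤-0≤ 0≤p 0≤q)

p≤p+q : ∀ {p q} → 0ℚ ≤ q → p ≤ p + q
p≤p+q {p} 0≤q = subst (_≤ p + _) (ℚP.+-identityʳ p) (ℚP.+-monoʳ-≤ p 0≤q)

p≤q+p : ∀ {p q} → 0ℚ ≤ q → p ≤ q + p
p≤q+p {p} {q} 0≤q = subst (p ≤_) (ℚP.+-comm p q) (p≤p+q 0≤q)

u*u≡∣u∣*∣u∣ : ∀ u → u * u ≡ ∣ u ∣ * ∣ u ∣
u*u≡∣u∣*∣u∣ u with ℚP.∣p∣≡p∨∣p∣≡-p u
... | inj₁ ∣u∣≡u  = cong₂ _*_ (sym ∣u∣≡u) (sym ∣u∣≡u)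
... | inj₂ ∣u∣≡-u = trans (neg*neg u) (cong₂ _*_ (sym ∣u∣≡-u) (sym ∣u∣≡-u))
  where
  open ℚSolver.+-*-Solver
  neg*neg : ∀ v → v * v ≡ (- v) * (- v)
  neg*neg = solve 1 (λ v → v :* v := (:- v) :* (:- v)) refl

∣u∣≤1+q : ∀ {u q} → u * u ≤ q → ∣ u ∣ ≤ 1ℚ + q
∣u∣≤1+q {u} {q} u²≤q with ∣ u ∣ ℚP.≤? 1ℚ
... | yes ∣u∣≤1 = ℚP.≤-trans ∣u∣≤1 (p≤p+q 0≤q)
  where
  0≤q : 0ℚ ≤ q
  0≤q = ℚP.≤-trans (0≤* (ℚP.0≤∣p∣ u) (ℚP.0≤∣p∣ u)) (subst (_≤ q) (u*u≡∣u∣*∣u∣ u) u²≤q)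
... | no  ∣u∣≰1 = begin
  ∣ u ∣              ≡⟨ sym (ℚP.*-identityʳ ∣ u ∣) ⟩
  ∣ u ∣ * 1ℚ         ≤⟨ *-monoˡ-≤-0≤ (ℚP.0≤∣p∣ u) (ℚP.<⇒≤ (ℚP.≰⇒> ∣u∣≰1)) ⟩
  ∣ u ∣ * ∣ u ∣      ≡⟨ sym (u*u≡∣u∣*∣u∣ u) ⟩
  u * u              ≤⟨ u²≤q ⟩
  q                  ≤⟨ p≤q+p (ℚP.nonNegative⁻¹ 1ℚ) ⟩
  1ℚ + q             ∎
  where open ℚP.≤-Reasoning

_◂_ : ∀ {n} → ℚ → Vec n → Vec (suc n)
(t ◂ y) zero    = t
(t ◂ y) (suc i) = y i

module Schur {n : ℕ} (G : Gram (suc n)) (G-sym : Symmetric G) where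

  a : ℚ
  a = G zero zero

  c : Vec n
  c i = G zero (suc i)

  G₁₁ : Gram n
  G₁₁ i j = G (suc i) (suc j)

  ℓ : Vec n → ℚ
  ℓ y = ΣFin n (λ i → c i * y i)

  tail : Vec (suc n) → Vec n
  tail x i = x (suc i)

  bil-head-tail : ∀ x → bil G x x ≡ (x zero * (a * x zero) + x zero * ℓ (tail x))
                                    + (x zero * ℓ (tail x) + bil G₁₁ (tail x) (tail x))
  bil-head-tail x =
    cong₂ _+_ (cong (_+_ (x zero * (a * x zero))) (sym (*-distribˡ-ΣFin n (x zero) _)))
              (trans (ΣFin-+ n (λ i → x (suc i) * (G (suc i) zero * x zero)) _)
                     (cong (_+ bil G₁₁ (tail x) (tail x)) column))
    where
    open ℚSolver.+-*-Solver
    column : ΣFin n (λ i → x (suc i) * (G (suc i) zero * x zero)) ≡ x zero * ℓ (tail x)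
    column = trans (ΣFin-cong n (λ i → trans (cong (λ t → x (suc i) * (t * x zero)) (G-sym (suc i) zero))
                     (solve 3 (λ p q r → p :* (q :* r) := r :* (q :* p)) refl (x (suc i)) (c i) (x zero))))
                   (sym (*-distribˡ-ΣFin n (x zero) _))

  pivot-pos : PosDef G → 0ℚ < a
  pivot-pos G>0 = subst (0ℚ <_) e₀-norm (G>0 e₀ (λ e₀≈0 → ℚP.1≢0 (e₀≈0 zero)))
    where
    open ℚSolver.+-*-Solver
    e₀ : Vec (suc n)
    e₀ = 1ℚ ◂ zeroV
    ℓ-zero : ℓ zeroV ≡ 0ℚ
    ℓ-zero = trans (ΣFin-cong n (λ i → ℚP.*-zeroʳ (c i))) (ΣFin-0 n)
    e₀-norm : bil G e₀ e₀ ≡ a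
    e₀-norm = trans (bil-head-tail e₀)
      (trans (cong₂ (λ l b → (1ℚ * (a * 1ℚ) + 1ℚ * l) + (1ℚ * l + b)) ℓ-zero (bil-zeroˡ G₁₁ zeroV (λ _ → refl)))
             (solve 1 (λ a → (con 1ℚ :* (a :* con 1ℚ) :+ con 1ℚ :* con 0ℚ) :+ (con 1ℚ :* con 0ℚ :+ con 0ℚ) := a) refl a))

  module Complement (0<a : 0ℚ < a) where

    instance
      a≢0 : ℚ.NonZero a
      a≢0 = ℚ.>-nonZero 0<a

    a⁻¹ : ℚ
    a⁻¹ = 1/ a

    S : Gram n
    S i j = G₁₁ i j + (- a⁻¹) * (c i * c j)

    S-sym : Symmetric S
    S-sym i j = cong₂ _+_ (G-sym (suc i) (suc j)) (cong (_*_ (- a⁻¹)) (ℚP.*-comm (c i) (c j)))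

    bil-S : ∀ y → bil S y y ≡ bil G₁₁ y y + (- a⁻¹) * (ℓ y * ℓ y)
    bil-S y = begin
      bil S y y
        ≡⟨ ΣFin-cong n (λ i → trans (ΣFin-cong n (λ j → expand (y i) (G₁₁ i j) (- a⁻¹) (c i) (c j) (y j)))
                                    (ΣFin-+ n _ _)) ⟩
      ΣFin n (λ i → ΣFin n (λ j → y i * (G₁₁ i j * y j)) + ΣFin n (λ j → (- a⁻¹) * (f i * f j)))
        ≡⟨ ΣFin-+ n _ _ ⟩
      bil G₁₁ y y + ΣFin n (λ i → ΣFin n (λ j → (- a⁻¹) * (f i * f j)))
        ≡⟨ cong (_+_ (bil G₁₁ y y)) (ΣFin-cong n (λ i → sym (*-distribˡ-ΣFin n (- a⁻¹) _))) ⟩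
      bil G₁₁ y y + ΣFin n (λ i → (- a⁻¹) * ΣFin n (λ j → f i * f j))
        ≡⟨ cong (_+_ (bil G₁₁ y y)) (sym (*-distribˡ-ΣFin n (- a⁻¹) _)) ⟩
      bil G₁₁ y y + (- a⁻¹) * ΣFin n (λ i → ΣFin n (λ j → f i * f j))
        ≡⟨ cong (λ t → bil G₁₁ y y + (- a⁻¹) * t) (ΣFin-square n f) ⟩
      bil G₁₁ y y + (- a⁻¹) * (ℓ y * ℓ y)
        ∎
      where
      open ≡-Reasoning
      open ℚSolver.+-*-Solver
      f : Fin n → ℚ
      f i = c i * y i
      expand : ∀ p g k ci cj q → p * ((g + k * (ci * cj)) * q) ≡ p * (g * q) + k * ((ci * p) * (cj * q))
      expand = solve 6 (λ p g k ci cj q →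
        p :* ((g :+ k :* (ci :* cj)) :* q) := p :* (g :* q) :+ k :* ((ci :* p) :* (cj :* q))) refl

    u : Vec (suc n) → ℚ
    u x = x zero + a⁻¹ * ℓ (tail x)

    complete-square : ∀ x → bil G x x ≡ a * (u x * u x) + bil S (tail x) (tail x)
    complete-square x = sym (begin
      a * (u x * u x) + bil S (tail x) (tail x)         ≡⟨ cong (_+_ (a * (u x * u x))) (bil-S (tail x)) ⟩
      a * (u x * u x) + (B + (- a⁻¹) * (L * L))        ≡⟨ regroup a a⁻¹ X L B ⟩
      N + (a * a⁻¹ + - 1ℚ) * Q                          ≡⟨ cong (λ t → N + (t + - 1ℚ) * Q) (ℚP.*-inverseʳ a) ⟩
      N + 0ℚ * Q                                        ≡⟨ cong (_+_ N) (ℚP.*-zeroˡ Q) ⟩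
      N + 0ℚ                                            ≡⟨ ℚP.+-identityʳ N ⟩
      N                                                 ≡⟨ sym (bil-head-tail x) ⟩
      bil G x x                                         ∎)
      where
      open ≡-Reasoning
      open ℚSolver.+-*-Solver
      X L B N Q : ℚ
      X = x zero
      L = ℓ (tail x)
      B = bil G₁₁ (tail x) (tail x)
      N = (X * (a * X) + X * L) + (X * L + B)
      Q = fromℤ (+ 2) * X * L + a⁻¹ * (L * L)
      regroup : ∀ a i x l b → a * ((x + i * l) * (x + i * l)) + (b + (- i) * (l * l))
                            ≡ ((x * (a * x) + x * l) + (x * l + b)) + (a * i + - 1ℚ) * (fromℤ (+ 2) * x * l + i * (l * l))
      regroup = solve 5 (λ a i x l b →
        a :* ((x :+ i :* l) :* (x :+ i :* l)) :+ (b :+ (:- i) :* (l :* l))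
        := ((x :* (a :* x) :+ x :* l) :+ (x :* l :+ b))
           :+ (a :* i :+ :- con 1ℚ) :* (con (fromℤ (+ 2)) :* x :* l :+ i :* (l :* l))) refl

    S-PosDef : PosDef G → PosDef S
    S-PosDef G>0 y y≉0 = subst (0ℚ <_) norm-x (G>0 x (λ x≈0 → y≉0 (x≈0 ∘ suc)))
      where
      open ℚSolver.+-*-Solver
      x : Vec (suc n)
      x = (- (a⁻¹ * ℓ y)) ◂ y
      norm-x : bil G x x ≡ bil S y y
      norm-x = trans (complete-square x)
        (trans (cong (λ t → a * (t * t) + bil S y y) (ℚP.+-inverseˡ (a⁻¹ * ℓ y)))
               (solve 2 (λ a b → a :* (con 0ℚ :* con 0ℚ) :+ b := b) refl a (bil S y y)))

PosDef⇒bounded : ∀ n (G : Gram n) → Symmetric G → PosDef G → ∀ b → 0ℚ ≤ b →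
                 ∃[ C ] (0ℚ ≤ C × (∀ x → bil G x x ≤ b → ∀ j → ∣ x j ∣ ≤ C))
PosDef⇒bounded zero    G G-sym G>0 b 0≤b = 0ℚ , ℚP.≤-refl , λ _ _ ()
PosDef⇒bounded (suc n) G G-sym G>0 b 0≤b = C₀ + C , ℚP.+-mono-≤ 0≤C₀ 0≤C , bound
  where
  open Schur G G-sym
  open Complement (pivot-pos G>0)

  tail-bounded : ∃[ C ] (0ℚ ≤ C × (∀ y → bil S y y ≤ b → ∀ j → ∣ y j ∣ ≤ C))
  tail-bounded = PosDef⇒bounded n S S-sym (S-PosDef G>0) b 0≤b

  C : ℚ
  C = proj₁ tail-bounded

  0≤C : 0ℚ ≤ C
  0≤C = proj₁ (proj₂ tail-bounded)

  ℓ-max : ℚ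
  ℓ-max = ΣFin n (λ i → ∣ c i ∣ * C)

  C₀ : ℚ
  C₀ = (1ℚ + a⁻¹ * b) + ∣ a⁻¹ ∣ * ℓ-max

  0≤a⁻¹ : 0ℚ ≤ a⁻¹
  0≤a⁻¹ = ℚP.nonNegative⁻¹ a⁻¹ {{ℚP.pos⇒nonNeg a⁻¹ {{ℚP.1/pos⇒pos a {{ℚ.positive (pivot-pos G>0)}}}}}}

  0≤C₀ : 0ℚ ≤ C₀
  0≤C₀ = ℚP.+-mono-≤ (ℚP.+-mono-≤ (ℚP.nonNegative⁻¹ 1ℚ) (0≤* 0≤a⁻¹ 0≤b))
                     (0≤* (ℚP.0≤∣p∣ a⁻¹) (ΣFin-nonNeg n _ (λ i → 0≤* (ℚP.0≤∣p∣ (c i)) 0≤C)))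

  ∣ℓ∣≤ℓ-max : ∀ y → (∀ i → ∣ y i ∣ ≤ C) → ∣ ℓ y ∣ ≤ ℓ-max
  ∣ℓ∣≤ℓ-max y y≤C = ℚP.≤-trans (∣ΣFin∣≤ΣFin∣∣ n _) (ΣFin-mono-≤ n (λ i →
    ℚP.≤-trans (ℚP.≤-reflexive (ℚP.∣p*q∣≡∣p∣*∣q∣ (c i) (y i))) (*-monoˡ-≤-0≤ (ℚP.0≤∣p∣ (c i)) (y≤C i))))

  bound : ∀ x → bil G x x ≤ b → ∀ j → ∣ x j ∣ ≤ C₀ + C
  bound x x≤b = λ { zero → ℚP.≤-trans head≤C₀ (p≤p+q 0≤C) ; (suc j) → ℚP.≤-trans (tail≤C j) (p≤q+p 0≤C₀) }
    where
    B : ℚ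
    B = bil S (tail x) (tail x)
    0≤B : 0ℚ ≤ B
    0≤B = PosDef⇒nonNeg {G = S} (S-PosDef G>0) (tail x)
    0≤au² : 0ℚ ≤ a * (u x * u x)
    0≤au² = 0≤* (ℚP.<⇒≤ (pivot-pos G>0))
                (subst (0ℚ ≤_) (sym (u*u≡∣u∣*∣u∣ (u x))) (0≤* (ℚP.0≤∣p∣ (u x)) (ℚP.0≤∣p∣ (u x))))
    au²+B≤b : a * (u x * u x) + B ≤ b
    au²+B≤b = subst (_≤ b) (complete-square x) x≤b
    tail≤C : ∀ j → ∣ x (suc j) ∣ ≤ C
    tail≤C = proj₂ (proj₂ tail-bounded) (tail x) (ℚP.≤-trans (p≤q+p 0≤au²) au²+B≤b)
    u²≤a⁻¹b : u x * u x ≤ a⁻¹ * b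
    u²≤a⁻¹b = subst (_≤ a⁻¹ * b) cancel (*-monoˡ-≤-0≤ 0≤a⁻¹ (ℚP.≤-trans (p≤p+q 0≤B) au²+B≤b))
      where
      cancel : a⁻¹ * (a * (u x * u x)) ≡ u x * u x
      cancel = trans (sym (ℚP.*-assoc a⁻¹ a _)) (trans (cong (_* (u x * u x)) (ℚP.*-inverseˡ a)) (ℚP.*-identityˡ _))
    head≤C₀ : ∣ x zero ∣ ≤ C₀
    head≤C₀ = begin
      ∣ x zero ∣                                  ≡⟨ cong ∣_∣ (add-sub (x zero) (a⁻¹ * ℓ (tail x))) ⟩
      ∣ u x + - (a⁻¹ * ℓ (tail x)) ∣              ≤⟨ ℚP.∣p+q∣≤∣p∣+∣q∣ (u x) _ ⟩
      ∣ u x ∣ + ∣ - (a⁻¹ * ℓ (tail x)) ∣          ≡⟨ cong (_+_ ∣ u x ∣) (trans (ℚP.∣-p∣≡∣p∣ _) (ℚP.∣p*q∣≡∣p∣*∣q∣ a⁻¹ _)) ⟩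
      ∣ u x ∣ + ∣ a⁻¹ ∣ * ∣ ℓ (tail x) ∣          ≤⟨ ℚP.+-mono-≤ (∣u∣≤1+q {u x} u²≤a⁻¹b)
                                                       (*-monoˡ-≤-0≤ (ℚP.0≤∣p∣ a⁻¹) (∣ℓ∣≤ℓ-max (tail x) tail≤C)) ⟩
      C₀                                          ∎
      where
      open ℚP.≤-Reasoning
      open ℚSolver.+-*-Solver
      add-sub : ∀ p q → p ≡ (p + q) + - q
      add-sub = solve 2 (λ p q → p := (p :+ q) :+ (:- q)) refl

-- Denominators, ranges and bounded search

↧*≡↥ : ∀ q → fromℤ (+ ↧ₙ q) * q ≡ fromℤ (↥ q)
↧*≡↥ q@(mkℚ n d _) = ℚP.toℚᵘ-injective (ℚᵘP.≃-trans (ℚP.toℚᵘ-homo-* (fromℤ (+ suc d)) q) (ℚᵘ.*≡* eq))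
  where
  eq : (+ suc d ℤ.* n) ℤ.* + 1 ≡ n ℤ.* + suc (d ℕ.+ 0)
  eq = trans (ℤP.*-identityʳ _) (trans (ℤP.*-comm (+ suc d) n) (cong (λ t → n ℤ.* + suc t) (sym (ℕP.+-identityʳ d))))

↧∣⇒IsInt : ∀ q N → ↧ₙ q ∣ N → IsInt (fromℤ (+ N) * q)
↧∣⇒IsInt q N (divides r refl) = subst IsInt (sym (begin
  fromℤ (+ (r ℕ.* ↧ₙ q)) * q              ≡⟨ cong (_* q) (trans (cong fromℤ (ℤP.pos-* r (↧ₙ q))) (sym (fromℤ-homo-* (+ r) (+ ↧ₙ q)))) ⟩
  (fromℤ (+ r) * fromℤ (+ ↧ₙ q)) * q      ≡⟨ ℚP.*-assoc (fromℤ (+ r)) (fromℤ (+ ↧ₙ q)) q ⟩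
  fromℤ (+ r) * (fromℤ (+ ↧ₙ q) * q)      ≡⟨ cong (_*_ (fromℤ (+ r))) (↧*≡↥ q) ⟩
  fromℤ (+ r) * fromℤ (↥ q)               ∎)) (IsInt-* (IsInt-fromℤ (+ r)) (IsInt-fromℤ (↥ q)))
  where open ≡-Reasoning

∏ : ∀ k → (Fin k → ℕ) → ℕ
∏ k f = product (List.tabulate f)

∣∏ : ∀ k (f : Fin k → ℕ) a → f a ∣ ∏ k f
∣∏ k f a = ∈⇒∣product (∈-tabulate⁺ a)

∏≢0 : ∀ k (f : Fin k → ℕ) → (∀ a → ℕ.NonZero (f a)) → ℕ.NonZero (∏ k f)
∏≢0 k f f≢0 = product≢0 (All.tabulate⁺ f≢0)

ceiling : ∀ q → ∃[ K ] q ≤ fromℤ (+ K)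
ceiling (mkℚ n d _) = ℤ.∣ n ∣ , ℚ.*≤* (begin
  n ℤ.* + 1                   ≡⟨ ℤP.*-identityʳ n ⟩
  n                           ≤⟨ i≤+∣i∣ n ⟩
  + ℤ.∣ n ∣                   ≤⟨ ℤ.+≤+ (ℕP.m≤m*n ℤ.∣ n ∣ (suc d)) ⟩
  + (ℤ.∣ n ∣ ℕ.* suc d)       ≡⟨ ℤP.pos-* ℤ.∣ n ∣ (suc d) ⟩
  + ℤ.∣ n ∣ ℤ.* + suc d       ∎)
  where
  open ℤP.≤-Reasoning
  i≤+∣i∣ : ∀ i → i ℤ.≤ + ℤ.∣ i ∣
  i≤+∣i∣ (+ m)     = ℤP.≤-refl
  i≤+∣i∣ -[1+ m ]  = ℤ.-≤+

range : ℕ → List ℤ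
range zero    = + 0 ∷ []
range (suc K) = + suc K ∷ -[1+ K ] ∷ range K

∈-range : ∀ K z → ℤ.∣ z ∣ ℕ.≤ K → z ∈ range K
∈-range zero    (+ zero)  _ = here refl
∈-range (suc K) (+ m)     m≤1+K with ℕP.m≤n⇒m<n∨m≡n m≤1+K
... | inj₁ (s≤s m≤K) = there (there (∈-range K (+ m) m≤K))
... | inj₂ refl      = here refl
∈-range (suc K) -[1+ m ] (s≤s m≤K) with ℕP.m≤n⇒m<n∨m≡n m≤K
... | inj₁ m<K  = there (there (∈-range K -[1+ m ] m<K))
... | inj₂ refl = there (here refl)

_◂ℤ_ : ∀ {n} → ℤ → (Fin n → ℤ) → Fin (suc n) → ℤ
(r ◂ℤ f) zero    = r
(r ◂ℤ f) (suc j) = f j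

∃-bounded? : ∀ n (R : List ℤ) {P : (Fin n → ℤ) → Set} → (∀ f → Dec (P f)) →
             (∀ {f g} → (∀ j → f j ≡ g j) → P f → P g) →
             Dec (∃ λ f → (∀ j → f j ∈ R) × P f)
∃-bounded? zero R P? P-resp =
  map′ (λ p → empty , (λ ()) , p) (λ (f , _ , p) → P-resp {f} (λ ()) p) (P? empty)
  where
  empty : Fin 0 → ℤ
  empty ()
∃-bounded? (suc n) R {P} P? P-resp = map′ join split (any? (λ r → ∃-bounded? n R (P? ∘ (r ◂ℤ_)) (P-resp ∘ ◂ℤ-cong r)) R)
  where
  ◂ℤ-cong : ∀ r {f g} → (∀ j → f j ≡ g j) → ∀ j → (r ◂ℤ f) j ≡ (r ◂ℤ g) j
  ◂ℤ-cong r f≗g zero    = refl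
  ◂ℤ-cong r f≗g (suc j) = f≗g j
  join : Any (λ r → ∃ λ f → (∀ j → f j ∈ R) × P (r ◂ℤ f)) R → ∃ λ f → (∀ j → f j ∈ R) × P f
  join found with find found
  ... | r , r∈R , f , f∈R , p = r ◂ℤ f , (λ { zero → r∈R ; (suc j) → f∈R j }) , p
  split : (∃ λ f → (∀ j → f j ∈ R) × P f) → Any (λ r → ∃ λ f → (∀ j → f j ∈ R) × P (r ◂ℤ f)) R
  split (f , f∈R , p) = lose (f∈R zero) ((f ∘ suc) , (f∈R ∘ suc) , P-resp (λ { zero → refl ; (suc j) → refl }) p)

-- Niemeier lattices

fromℕ-nonZero : ∀ N → ℕ.NonZero N → ℚ.NonZero (fromℤ (+ N))
fromℕ-nonZero (suc m) _ = _

fromℕ-nonNeg : ∀ N → ℚ.NonNegative (fromℤ (+ N))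
fromℕ-nonNeg N = ℚ.nonNegative (fromℤ-mono-≤ (+≤+ z≤n))

*-cancelˡ-≡0 : ∀ r .{{_ : ℚ.NonZero r}} {p} → r * p ≡ 0ℚ → p ≡ 0ℚ
*-cancelˡ-≡0 r {p} rp≡0 = begin
  p                  ≡⟨ sym (ℚP.*-identityˡ p) ⟩
  1ℚ * p             ≡⟨ cong (_* p) (sym (ℚP.*-inverseˡ r)) ⟩
  (1/ r * r) * p     ≡⟨ ℚP.*-assoc (1/ r) r p ⟩
  1/ r * (r * p)     ≡⟨ cong (_*_ (1/ r)) rp≡0 ⟩
  1/ r * 0ℚ          ≡⟨ ℚP.*-zeroʳ (1/ r) ⟩
  0ℚ                 ∎
  where open ≡-Reasoning

module NiemeierLattice (H : Gram 24) (H-sym : Symmetric H) {k : ℕ} (g : Fin k → Vec 24)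
                       (L-Niemeier : IsNiemeier H (Span k g)) where

  L : Vec 24 → Set
  L = Span k g

  L⇒integral-pairings : ∀ {x} → L x → ∀ a → IsInt (bil H x (g a))
  L⇒integral-pairings x∈L a = proj₁ (proj₂ L-Niemeier) _ (g a) x∈L (Span-generator g a)

  integral-pairings⇒L : ∀ x → (∀ a → IsInt (bil H x (g a))) → L x
  integral-pairings⇒L x x·g∈ℤ = proj₂ (proj₂ (proj₂ L-Niemeier)) x λ y y∈L →
    subst IsInt (bil-sym H H-sym y x) (pairing y y∈L)
    where
    pairing : ∀ y → L y → IsInt (bil H y x)
    pairing y (c , y≡Σ) = subst IsInt (sym (bil-ΣFinˡ H k (λ a → c a · g a) x y≡Σ))
      (ΣFin-IsInt k _ λ a → subst IsInt (sym (bil-·ˡ H (c a) (g a) x))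
        (IsInt-* (c a , refl) (subst IsInt (bil-sym H H-sym x (g a)) (x·g∈ℤ a))))

  L? : ∀ x → Dec (L x)
  L? x = map′ (integral-pairings⇒L x) L⇒integral-pairings (all? (λ a → IsInt? (bil H x (g a))))

  norm-scale : ∀ N x → bil H ((+ N) · x) ((+ N) · x) ≡ fromℤ (+ N) * (fromℤ (+ N) * bil H x x)
  norm-scale N x = trans (bil-·ˡ H (+ N) x ((+ N) · x)) (cong₂ _*_ (/1≡fromℤ (+ N))
                         (trans (bil-·ʳ H (+ N) x x) (cong (_* bil H x x) (/1≡fromℤ (+ N)))))

  -- L equals its dual, so clearing the denominators of the pairings (x, gₐ) puts a multiple of x into L.
  clear-denominators : ∀ x → ∃[ N ] (ℕ.NonZero N × L ((+ N) · x))
  clear-denominators x = N , ∏≢0 k _ (λ _ → _) , integral-pairings⇒L ((+ N) · x) λ a →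
    subst IsInt (sym (trans (bil-·ˡ H (+ N) x (g a)) (cong (_* bil H x (g a)) (/1≡fromℤ (+ N)))))
          (↧∣⇒IsInt (bil H x (g a)) N (∣∏ k (λ b → ↧ₙ bil H x (g b)) a))
    where
    N = ∏ k (λ a → ↧ₙ bil H x (g a))

  H-PosDef : PosDef H
  H-PosDef x x≉0 = ℚP.*-cancelˡ-<-nonNeg N′ {{fromℕ-nonNeg N}} (ℚP.*-cancelˡ-<-nonNeg N′ {{fromℕ-nonNeg N}}
    (subst₂ _<_ (sym (trans (cong (_*_ N′) (ℚP.*-zeroʳ N′)) (ℚP.*-zeroʳ N′))) (norm-scale N x)
            (proj₁ L-Niemeier ((+ N) · x) Nx∈L Nx≉0)))
    where
    N : ℕ
    N = proj₁ (clear-denominators x)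
    N′ : ℚ
    N′ = fromℤ (+ N)
    Nx∈L : L ((+ N) · x)
    Nx∈L = proj₂ (proj₂ (clear-denominators x))
    Nx≉0 : NonZeroV ((+ N) · x)
    Nx≉0 Nx≈0 = x≉0 λ j → *-cancelˡ-≡0 N′ {{fromℕ-nonZero N (proj₁ (proj₂ (clear-denominators x)))}}
                              (trans (cong (_* x j) (sym (/1≡fromℤ (+ N)))) (Nx≈0 j))

  D : ℕ
  D = ∏ k (λ a → ∏ 24 (λ j → ↧ₙ g a j))

  instance
    D≢0 : ℚ.NonZero (fromℤ (+ D))
    D≢0 = fromℕ-nonZero D (∏≢0 k (λ a → ∏ 24 (λ j → ↧ₙ g a j)) (λ a → ∏≢0 24 (λ j → ↧ₙ g a j) (λ _ → _)))

  D*coordinate-IsInt : ∀ {x} → L x → ∀ j → IsInt (fromℤ (+ D) * x j)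
  D*coordinate-IsInt (c , x≡Σ) j =
    subst IsInt (sym (trans (cong (_*_ D′) (x≡Σ j)) (*-distribˡ-ΣFin k D′ term)))
      (ΣFin-IsInt k (λ a → D′ * term a) λ a → subst IsInt (left-comm (c a / 1) D′ (g a j))
        (IsInt-* (c a , refl) (↧∣⇒IsInt (g a j) D (∣-trans (∣∏ 24 (λ i → ↧ₙ g a i) j) (∣∏ k (λ b → ∏ 24 (λ i → ↧ₙ g b i)) a)))))
    where
    open ℚSolver.+-*-Solver
    D′ : ℚ
    D′ = fromℤ (+ D)
    term : Fin k → ℚ
    term a = (c a / 1) * g a j
    left-comm : ∀ u d v → u * (d * v) ≡ d * (u * v)
    left-comm = solve 3 (λ u d v → u :* (d :* v) := d :* (u :* v)) refl

  integer-coordinates : ∀ {x} → L x → ∃ λ (z : Fin 24 → ℤ) → ∀ j → fromℤ (+ D) * x j ≡ fromℤ (z j)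
  integer-coordinates {x} x∈L = (λ j → proj₁ (Dx j)) , (λ j → proj₂ (Dx j))
    where
    Dx : ∀ j → ∃[ z ] (fromℤ (+ D) * x j ≡ fromℤ z)
    Dx j = IsInt⇒≡fromℤ (D*coordinate-IsInt x∈L j)

  D⁻¹ : ℚ
  D⁻¹ = 1/ fromℤ (+ D)

  candidate : (Fin 24 → ℤ) → Vec 24
  candidate z j = fromℤ (z j) * D⁻¹

  ≈candidate : ∀ {x z} → (∀ j → fromℤ (+ D) * x j ≡ fromℤ (z j)) → x ≈ candidate z
  ≈candidate {x} {z} Dx≡z j = begin
    x j                                        ≡⟨ sym (ℚP.*-identityʳ (x j)) ⟩
    x j * 1ℚ                                   ≡⟨ cong (_*_ (x j)) (sym (ℚP.*-inverseʳ (fromℤ (+ D)))) ⟩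
    x j * (fromℤ (+ D) * D⁻¹)                  ≡⟨ regroup (x j) (fromℤ (+ D)) D⁻¹ ⟩
    (fromℤ (+ D) * x j) * D⁻¹                  ≡⟨ cong₂ _*_ (Dx≡z j) (refl {x = D⁻¹}) ⟩
    fromℤ (z j) * D⁻¹                          ∎
    where
    open ≡-Reasoning
    open ℚSolver.+-*-Solver
    regroup : ∀ a b c → a * (b * c) ≡ (b * a) * c
    regroup = solve 3 (λ a b c → a :* (b :* c) := (b :* a) :* c) refl

  module _ (b : ℚ) (0≤b : 0ℚ ≤ b) where

    HasNorm : Vec 24 → Set
    HasNorm x = L x × bil H x x ≡ b

    HasNorm-resp : ∀ {x y} → x ≈ y → HasNorm x → HasNorm y
    HasNorm-resp x≈y (x∈L , x²≡b) = Span-resp g x≈y x∈L , trans (sym (bil-cong H x≈y x≈y)) x²≡b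

    HasNorm? : ∀ z → Dec (HasNorm (candidate z))
    HasNorm? z = L? (candidate z) ×-dec (bil H (candidate z) (candidate z) ℚP.≟ b)

    bounded : ∃[ C ] (0ℚ ≤ C × (∀ x → bil H x x ≤ b → ∀ j → ∣ x j ∣ ≤ C))
    bounded = PosDef⇒bounded 24 H H-sym H-PosDef b 0≤b

    K : ℕ
    K = proj₁ (ceiling (fromℤ (+ D) * proj₁ bounded))

    integer-coordinates∈range : ∀ {x : Vec 24} {z : Fin 24 → ℤ} → bil H x x ≡ b → (∀ j → fromℤ (+ D) * x j ≡ fromℤ (z j)) →
                                ∀ j → z j ∈ range K
    integer-coordinates∈range {x} {z} x²≡b Dx≡z j = ∈-range K (z j) (drop+ (fromℤ-cancel-≤ {+ ℤ.∣ z j ∣} {+ K} (begin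
      ∣ fromℤ (z j) ∣                         ≡⟨ cong ∣_∣ (sym (Dx≡z j)) ⟩
      ∣ fromℤ (+ D) * x j ∣                   ≡⟨ ℚP.∣p*q∣≡∣p∣*∣q∣ (fromℤ (+ D)) (x j) ⟩
      fromℤ (+ D) * ∣ x j ∣                   ≤⟨ ℚP.*-monoˡ-≤-nonNeg (fromℤ (+ D)) {{fromℕ-nonNeg D}}
                                                   (proj₂ (proj₂ bounded) x (ℚP.≤-reflexive x²≡b) j) ⟩
      fromℤ (+ D) * proj₁ bounded             ≤⟨ proj₂ (ceiling (fromℤ (+ D) * proj₁ bounded)) ⟩
      fromℤ (+ K)                             ∎)))
      where
      open ℚP.≤-Reasoning
      drop+ : ∀ {m n} → + m ℤ.≤ + n → m ℕ.≤ n
      drop+ (+≤+ m≤n) = m≤n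

    norm? : Dec (∃ λ x → L x × bil H x x ≡ b)
    norm? = map′ (λ (z , _ , z∈N) → candidate z , z∈N) search-space
                 (∃-bounded? 24 (range K) HasNorm? λ z≗z′ → HasNorm-resp (λ j → cong₂ _*_ (cong fromℤ (z≗z′ j)) (refl {x = D⁻¹})))
      where
      search-space : (∃ λ x → L x × bil H x x ≡ b) → ∃ λ z → (∀ j → z j ∈ range K) × HasNorm (candidate z)
      search-space (x , x∈L , x²≡b) = from-coordinates (integer-coordinates x∈L)
        where
        from-coordinates : (∃ λ z → ∀ j → fromℤ (+ D) * x j ≡ fromℤ (z j)) →
                           ∃ λ z → (∀ j → z j ∈ range K) × HasNorm (candidate z)
        from-coordinates (z , Dx≡z) =
          z , integer-coordinates∈range {x} x²≡b Dx≡z , HasNorm-resp (≈candidate {x} Dx≡z) (x∈L , x²≡b)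

  ¬Leech⇒norm-2 : ¬ IsLeech H L → ∃ λ x → L x × bil H x x ≡ + 2 / 1
  ¬Leech⇒norm-2 ¬Leech = decided (norm? (+ 2 / 1) (fromℤ-mono-≤ (+≤+ z≤n)))
    where
    decided : Dec (∃ λ x → L x × bil H x x ≡ + 2 / 1) → ∃ λ x → L x × bil H x x ≡ + 2 / 1
    decided (yes found) = found
    decided (no  none)  = ⊥-elim (¬Leech (L-Niemeier , λ x x∈L x²≡2 → none (x , x∈L , x²≡2)))

NormsAtLeast : ∀ {n} → Gram n → (Vec n → Set) → ℚ → Set
NormsAtLeast G L q = ∀ x → L x → NonZeroV x → q ≤ bil G x x

0<2w⇒1≤w : ∀ w → + 0 ℤ.< + 2 ℤ.* w → + 1 ℤ.≤ w
0<2w⇒1≤w (+ zero)  (+<+ ())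
0<2w⇒1≤w (+ suc n) _ = +≤+ (s≤s z≤n)

1≤w≢1⇒2≤w : ∀ w → + 1 ℤ.≤ w → w ≢ + 1 → + 2 ℤ.≤ w
1≤w≢1⇒2≤w (+ zero)          (+≤+ ())
1≤w≢1⇒2≤w (+ suc zero)      _ w≢1 = ⊥-elim (w≢1 refl)
1≤w≢1⇒2≤w (+ suc (suc n))   _ _   = +≤+ (s≤s (s≤s z≤n))

3≤2K⇒4≤2K : ∀ K → + 3 ℤ.≤ + 2 ℤ.* K → + 4 ℤ.≤ + 2 ℤ.* K
3≤2K⇒4≤2K (+ zero)          (+≤+ ())
3≤2K⇒4≤2K (+ suc zero)      (+≤+ (s≤s (s≤s ())))
3≤2K⇒4≤2K (+ suc (suc n))   _ = ℤP.*-monoˡ-≤-nonNeg (+ 2) (+≤+ (s≤s (s≤s z≤n)))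

Niemeier-norm : ∀ {G L} → IsNiemeier G L → ∀ x → L x → NonZeroV x →
                ∃[ w ] (bil G x x ≡ fromℤ (+ 2 ℤ.* w) × + 1 ℤ.≤ w)
Niemeier-norm {G} {L} L-Niemeier x x∈L x≉0 = positive (IsEven⇒≡fromℤ (proj₁ (proj₂ (proj₂ L-Niemeier)) x x∈L))
  where
  positive : ∃[ w ] (bil G x x ≡ fromℤ (+ 2 ℤ.* w)) → ∃[ w ] (bil G x x ≡ fromℤ (+ 2 ℤ.* w) × + 1 ℤ.≤ w)
  positive (w , x²≡2w) =
    w , x²≡2w , 0<2w⇒1≤w w (fromℤ-cancel-< (subst (0ℚ <_) x²≡2w (proj₁ L-Niemeier x x∈L x≉0)))

Niemeier-norms≥2 : ∀ {G L} → IsNiemeier G L → NormsAtLeast G L (fromℤ (+ 2))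
Niemeier-norms≥2 {G} {L} L-Niemeier x x∈L x≉0 =
  let w , x²≡2w , 1≤w = Niemeier-norm {G} {L} L-Niemeier x x∈L x≉0
  in subst (fromℤ (+ 2) ≤_) (sym x²≡2w) (fromℤ-mono-≤ {+ 2} (ℤP.*-monoˡ-≤-nonNeg (+ 2) 1≤w))

Leech-norms≥4 : ∀ {G L} → IsLeech G L → NormsAtLeast G L (fromℤ (+ 4))
Leech-norms≥4 {G} {L} (L-Niemeier , no-roots) x x∈L x≉0 =
  let w , x²≡2w , 1≤w = Niemeier-norm {G} {L} L-Niemeier x x∈L x≉0
      2≤w = 1≤w≢1⇒2≤w w 1≤w (λ w≡1 → no-roots x x∈L (trans x²≡2w (cong (λ v → fromℤ (+ 2 ℤ.* v)) w≡1)))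
  in subst (fromℤ (+ 4) ≤_) (sym x²≡2w) (fromℤ-mono-≤ {+ 4} (ℤP.*-monoˡ-≤-nonNeg (+ 2) 2≤w))

NormsAtLeast-half : ∀ {n} {G : Gram n} {L q} → NormsAtLeast G L q → NormsAtLeast (half G) L (½ * q)
NormsAtLeast-half {G = G} {q = q} L≥q x x∈L x≉0 =
  subst (½ * q ≤_) (sym (bil-half G x x)) (ℚP.*-monoˡ-≤-nonNeg ½ (L≥q x x∈L x≉0))

-- The lattice L(M,N,3)

module Construction (G : Gram 24) (G-sym : Symmetric G) {kU kM kN : ℕ}
                    (gU : Fin kU → Vec 24) (gM : Fin kM → Vec 24) (gN : Fin kN → Vec 24)
                    (pol : IsPolarization (half G) (Span kU gU) (Span kM gM) (Span kN gN))
                    (M-Niemeier : IsNiemeier (half G) (Span kM gM))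
                    (N-Niemeier : IsNiemeier (half G) (Span kN gN)) where

  H : Gram 24
  H = half G

  U M N : Vec 24 → Set
  U = Span kU gU
  M = Span kM gM
  N = Span kN gN

  M⊆U : M ⊆ U
  M⊆U = proj₁ pol

  N⊆U : N ⊆ U
  N⊆U = proj₁ (proj₂ pol)

  M∩N⊆2U : ∀ x → M x × N x → ∃[ u ] (U u × x ≈ ((+ 2) · u))
  M∩N⊆2U = proj₁ (proj₂ (proj₂ (proj₂ (proj₂ (proj₂ pol)))))

  record Decomposition (x₁ x₂ x₃ : Vec 24) : Set where
    field
      a₁ a₂ a₃ y : Vec 24
      a₁∈M : M a₁
      a₂∈M : M a₂
      a₃∈M : M a₃
      Σa∈N : N (a₁ ⊕ (a₂ ⊕ a₃))
      y∈N  : N y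
      x₁≈  : x₁ ≈ (a₁ ⊕ y)
      x₂≈  : x₂ ≈ (a₂ ⊕ y)
      x₃≈  : x₃ ≈ (a₃ ⊕ y)

    x₁∈U : U x₁
    x₁∈U = Span-≈+ gU x₁≈ (M⊆U _ a₁∈M) (N⊆U _ y∈N)
    x₂∈U : U x₂
    x₂∈U = Span-≈+ gU x₂≈ (M⊆U _ a₂∈M) (N⊆U _ y∈N)
    x₃∈U : U x₃
    x₃∈U = Span-≈+ gU x₃≈ (M⊆U _ a₃∈M) (N⊆U _ y∈N)

    Σx∈N : N (x₁ ⊕ (x₂ ⊕ x₃))
    Σx∈N = Span-resp gN Σa+3y≈Σx (Span-+ gN Σa∈N (Span-+ gN y∈N (Span-+ gN y∈N y∈N)))
      where
      open ℚSolver.+-*-Solver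
      Σa+3y≈Σx : ((a₁ ⊕ (a₂ ⊕ a₃)) ⊕ (y ⊕ (y ⊕ y))) ≈ (x₁ ⊕ (x₂ ⊕ x₃))
      Σa+3y≈Σx j = sym (trans (cong₂ _+_ (x₁≈ j) (cong₂ _+_ (x₂≈ j) (x₃≈ j)))
        (solve 4 (λ p q r s → (p :+ s) :+ ((q :+ s) :+ (r :+ s)) := (p :+ (q :+ r)) :+ (s :+ (s :+ s)))
               refl (a₁ j) (a₂ j) (a₃ j) (y j)))

    y∈M⇒x∈M : M y → M x₁ × M x₂ × M x₃
    y∈M⇒x∈M y∈M = Span-≈+ gM x₁≈ a₁∈M y∈M , Span-≈+ gM x₂≈ a₂∈M y∈M , Span-≈+ gM x₃≈ a₃∈M y∈M

  decompose : ∀ {x₁ x₂ x₃} → L3 M N (x₁ , x₂ , x₃) → Decomposition x₁ x₂ x₃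
  decompose ((a₁ , a₂ , a₃) , (b₁ , b₂ , b₃) , (a₁∈M , a₂∈M , a₃∈M , _ , Σa∈N) ,
             (y , y∈N , b₁≈y , b₂≈y , b₃≈y) , x₁≈ , x₂≈ , x₃≈) = record
    { a₁ = a₁ ; a₂ = a₂ ; a₃ = a₃ ; y = y
    ; a₁∈M = a₁∈M ; a₂∈M = a₂∈M ; a₃∈M = a₃∈M ; Σa∈N = Σa∈N ; y∈N = y∈N
    ; x₁≈ = λ j → trans (x₁≈ j) (cong (_+_ (a₁ j)) (b₁≈y j))
    ; x₂≈ = λ j → trans (x₂≈ j) (cong (_+_ (a₂ j)) (b₂≈y j))
    ; x₃≈ = λ j → trans (x₃≈ j) (cong (_+_ (a₃ j)) (b₃≈y j))
    }

  H-sym : Symmetric H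
  H-sym = half-symmetric G-sym

  norm₃-even : ∀ {x₁ x₂ x₃} → Decomposition x₁ x₂ x₃ → IsEven (norm₃ H (x₁ , x₂ , x₃))
  norm₃-even {x₁} {x₂} {x₃} d = subst IsEven (sym expansion)
    (IsEven-+ (M-even a₁ a₁∈M) (IsEven-+ (M-even a₂ a₂∈M) (IsEven-+ (M-even a₃ a₃∈M)
      (IsEven-+ (IsEven-2* (N-integral _ y Σa∈N y∈N)) (IsEven-* (IsInt-fromℤ (+ 3)) (N-even y y∈N))))))
    where
    open Decomposition d
    open ≡-Reasoning
    M-even : ∀ x → M x → IsEven (bil H x x)
    M-even = proj₁ (proj₂ (proj₂ M-Niemeier))
    N-even : ∀ x → N x → IsEven (bil H x x)
    N-even = proj₁ (proj₂ (proj₂ N-Niemeier))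
    N-integral : ∀ x y → N x → N y → IsInt (bil H x y)
    N-integral = proj₁ (proj₂ N-Niemeier)
    A₁ A₂ A₃ P₁ P₂ P₃ Y : ℚ
    A₁ = bil H a₁ a₁
    A₂ = bil H a₂ a₂
    A₃ = bil H a₃ a₃
    P₁ = bil H a₁ y
    P₂ = bil H a₂ y
    P₃ = bil H a₃ y
    Y = bil H y y
    collect : ∀ A₁ A₂ A₃ P₁ P₂ P₃ Y →
              (A₁ + (fromℤ (+ 2) * P₁ + Y)) + ((A₂ + (fromℤ (+ 2) * P₂ + Y)) + (A₃ + (fromℤ (+ 2) * P₃ + Y)))
              ≡ A₁ + (A₂ + (A₃ + (fromℤ (+ 2) * (P₁ + (P₂ + P₃)) + fromℤ (+ 3) * Y)))
    collect = solve 7 (λ A₁ A₂ A₃ P₁ P₂ P₃ Y →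
      (A₁ :+ (con (fromℤ (+ 2)) :* P₁ :+ Y)) :+ ((A₂ :+ (con (fromℤ (+ 2)) :* P₂ :+ Y)) :+ (A₃ :+ (con (fromℤ (+ 2)) :* P₃ :+ Y)))
      := A₁ :+ (A₂ :+ (A₃ :+ (con (fromℤ (+ 2)) :* (P₁ :+ (P₂ :+ P₃)) :+ con (fromℤ (+ 3)) :* Y)))) refl
      where open ℚSolver.+-*-Solver
    expansion : norm₃ H (x₁ , x₂ , x₃)
              ≡ A₁ + (A₂ + (A₃ + (fromℤ (+ 2) * bil H (a₁ ⊕ (a₂ ⊕ a₃)) y + fromℤ (+ 3) * Y)))
    expansion = begin
      norm₃ H (x₁ , x₂ , x₃)
        ≡⟨ cong₂ _+_ (bil-cong H x₁≈ x₁≈) (cong₂ _+_ (bil-cong H x₂≈ x₂≈) (bil-cong H x₃≈ x₃≈)) ⟩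
      bil H (a₁ ⊕ y) (a₁ ⊕ y) + (bil H (a₂ ⊕ y) (a₂ ⊕ y) + bil H (a₃ ⊕ y) (a₃ ⊕ y))
        ≡⟨ cong₂ _+_ (bil-expand H H-sym a₁ y) (cong₂ _+_ (bil-expand H H-sym a₂ y) (bil-expand H H-sym a₃ y)) ⟩
      (A₁ + (fromℤ (+ 2) * P₁ + Y)) + ((A₂ + (fromℤ (+ 2) * P₂ + Y)) + (A₃ + (fromℤ (+ 2) * P₃ + Y)))
        ≡⟨ collect A₁ A₂ A₃ P₁ P₂ P₃ Y ⟩
      A₁ + (A₂ + (A₃ + (fromℤ (+ 2) * (P₁ + (P₂ + P₃)) + fromℤ (+ 3) * Y)))
        ≡⟨ cong (λ t → A₁ + (A₂ + (A₃ + (fromℤ (+ 2) * t + fromℤ (+ 3) * Y))))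
                (sym (trans (bil-+ˡ H a₁ (a₂ ⊕ a₃) y) (cong (_+_ P₁) (bil-+ˡ H a₂ a₃ y)))) ⟩
      A₁ + (A₂ + (A₃ + (fromℤ (+ 2) * bil H (a₁ ⊕ (a₂ ⊕ a₃)) y + fromℤ (+ 3) * Y)))
        ∎

  M∩N-norms : ∀ {q} → NormsAtLeast H U q → NormsAtLeast H (λ x → M x × N x) (fromℤ (+ 4) * q)
  M∩N-norms {q} U≥q x x∈M∩N x≉0 = from-2U (M∩N⊆2U x x∈M∩N)
    where
    open ℚP.≤-Reasoning
    from-2U : ∃[ u ] (U u × x ≈ ((+ 2) · u)) → fromℤ (+ 4) * q ≤ bil H x x
    from-2U (u , u∈U , x≈2u) = begin
        fromℤ (+ 4) * q                               ≤⟨ ℚP.*-monoˡ-≤-nonNeg (fromℤ (+ 4)) (U≥q u u∈U u≉0) ⟩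
        fromℤ (+ 4) * bil H u u                       ≡⟨ cong₂ _*_ (sym (fromℤ-homo-* (+ 2) (+ 2))) (refl {x = bil H u u}) ⟩
        (fromℤ (+ 2) * fromℤ (+ 2)) * bil H u u       ≡⟨ ℚP.*-assoc (fromℤ (+ 2)) (fromℤ (+ 2)) (bil H u u) ⟩
        fromℤ (+ 2) * (fromℤ (+ 2) * bil H u u)       ≡⟨ cong (_*_ (fromℤ (+ 2))) (sym (bil-·ʳ H (+ 2) u u)) ⟩
        fromℤ (+ 2) * bil H u ((+ 2) · u)             ≡⟨ sym (bil-·ˡ H (+ 2) u ((+ 2) · u)) ⟩
        bil H ((+ 2) · u) ((+ 2) · u)                 ≡⟨ sym (bil-cong H x≈2u x≈2u) ⟩
        bil H x x                                     ∎
      where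
      u≉0 : NonZeroV u
      u≉0 u≈0 = x≉0 λ j → trans (x≈2u j) (trans (cong (_*_ (fromℤ (+ 2))) (u≈0 j)) (ℚP.*-zeroʳ (fromℤ (+ 2))))

  -- One nonzero coordinate lies in M ∩ N = 2U, two nonzero coordinates lie in M, and with
  -- three nonzero coordinates in U the evenness of norm₃ rounds 3 qU up; hence the three bounds on t.
  module Bound (t qU qM : ℚ) (U≥qU : NormsAtLeast H U qU) (M≥qM : NormsAtLeast H M qM)
               (t≤4qU : t ≤ fromℤ (+ 4) * qU) (t≤2qM : t ≤ qM + qM)
               (t≤even : ∀ K → qU + (qU + qU) ≤ fromℤ (+ 2 ℤ.* K) → t ≤ fromℤ (+ 2 ℤ.* K)) where

    +norm0 : ∀ {q} {w : Vec 24} → w ≈ zeroV → q + bil H w w ≡ q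
    +norm0 {q} {w} w≈0 = trans (cong (_+_ q) (bil-zeroˡ H w w≈0)) (ℚP.+-identityʳ q)

    norm0+ : ∀ {v : Vec 24} {q} → v ≈ zeroV → bil H v v + q ≡ q
    norm0+ {v} {q} v≈0 = trans (cong (_+ q) (bil-zeroˡ H v v≈0)) (ℚP.+-identityˡ q)

    single-bound : ∀ {v w} → M v → N v → NonZeroV v → w ≈ zeroV → t ≤ bil H v v + bil H w w
    single-bound v∈M v∈N v≉0 w≈0 = ℚP.≤-trans t≤4qU
      (ℚP.≤-trans (M∩N-norms {qU} U≥qU _ (v∈M , v∈N) v≉0) (ℚP.≤-reflexive (sym (+norm0 w≈0))))

    pair-bound : ∀ {v w} → M v → M w → N (v ⊕ w) → ¬ (v ≈ zeroV × w ≈ zeroV) →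
                 t ≤ bil H v v + bil H w w
    pair-bound {v} {w} v∈M w∈M v+w∈N v,w≉0 = by-cases (≈zeroV? v) (≈zeroV? w)
      where
      by-cases : Dec (v ≈ zeroV) → Dec (w ≈ zeroV) → t ≤ bil H v v + bil H w w
      by-cases (yes v≈0) (yes w≈0) = ⊥-elim (v,w≉0 (v≈0 , w≈0))
      by-cases (no  v≉0) (no  w≉0) = ℚP.≤-trans t≤2qM (ℚP.+-mono-≤ (M≥qM v v∈M v≉0) (M≥qM w w∈M w≉0))
      by-cases (no  v≉0) (yes w≈0) = single-bound v∈M (Span-resp gN (⊕-identityʳ w≈0) v+w∈N) v≉0 w≈0
      by-cases (yes v≈0) (no  w≉0) = subst (t ≤_) (ℚP.+-comm (bil H w w) (bil H v v))
                                       (single-bound w∈M (Span-resp gN (⊕-identityˡ v≈0) v+w∈N) w≉0 v≈0)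

    L3-MinGE : MinGE (L3 M N) (norm₃ H) t
    L3-MinGE (x₁ , x₂ , x₃) x∈L x≉0 = by-cases (≈zeroV? x₁) (≈zeroV? x₂) (≈zeroV? x₃)
      where
      open Decomposition (decompose x∈L)
      n₁ n₂ n₃ : ℚ
      n₁ = bil H x₁ x₁
      n₂ = bil H x₂ x₂
      n₃ = bil H x₃ x₃
      all-nonzero : NonZeroV x₁ → NonZeroV x₂ → NonZeroV x₃ →
                    ∃[ K ] (n₁ + (n₂ + n₃) ≡ fromℤ (+ 2 ℤ.* K)) → t ≤ n₁ + (n₂ + n₃)
      all-nonzero x₁≉0 x₂≉0 x₃≉0 (K , norm≡2K) = subst (t ≤_) (sym norm≡2K) (t≤even K (subst (qU + (qU + qU) ≤_) norm≡2K
        (ℚP.+-mono-≤ (U≥qU x₁ x₁∈U x₁≉0) (ℚP.+-mono-≤ (U≥qU x₂ x₂∈U x₂≉0) (U≥qU x₃ x₃∈U x₃≉0)))))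
      by-cases : Dec (x₁ ≈ zeroV) → Dec (x₂ ≈ zeroV) → Dec (x₃ ≈ zeroV) → t ≤ n₁ + (n₂ + n₃)
      by-cases (yes x₁≈0) _ _ =
        let _ , x₂∈M , x₃∈M = y∈M⇒x∈M (Span-⊕-cancelˡ gM x₁≈ x₁≈0 a₁∈M) in
        subst (t ≤_) (sym (norm0+ x₁≈0))
          (pair-bound x₂∈M x₃∈M (Span-resp gN (⊕-identityˡ x₁≈0) Σx∈N) λ (x₂≈0 , x₃≈0) → x≉0 (x₁≈0 , x₂≈0 , x₃≈0))
      by-cases (no x₁≉0) (yes x₂≈0) _ =
        let x₁∈M , _ , x₃∈M = y∈M⇒x∈M (Span-⊕-cancelˡ gM x₂≈ x₂≈0 a₂∈M) in
        subst (t ≤_) (cong (_+_ n₁) (sym (norm0+ x₂≈0)))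
          (pair-bound x₁∈M x₃∈M (Span-resp gN (λ j → cong (_+_ (x₁ j)) (⊕-identityˡ {v = x₂} {x₃} x₂≈0 j)) Σx∈N) (x₁≉0 ∘ proj₁))
      by-cases (no x₁≉0) (no _) (yes x₃≈0) =
        let x₁∈M , x₂∈M , _ = y∈M⇒x∈M (Span-⊕-cancelˡ gM x₃≈ x₃≈0 a₃∈M) in
        subst (t ≤_) (cong (_+_ n₁) (sym (+norm0 x₃≈0)))
          (pair-bound x₁∈M x₂∈M (Span-resp gN (λ j → cong (_+_ (x₁ j)) (⊕-identityʳ {v = x₂} x₃≈0 j)) Σx∈N) (x₁≉0 ∘ proj₁))
      by-cases (no x₁≉0) (no x₂≉0) (no x₃≉0) =
        all-nonzero x₁≉0 x₂≉0 x₃≉0 (IsEven⇒≡fromℤ (norm₃-even (decompose x∈L)))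

  norm-2⇒≉0 : ∀ {x : Vec 24} → bil H x x ≡ + 2 / 1 → NonZeroV x
  norm-2⇒≉0 {x} x²≡2 x≈0 = 2≢0 (trans (sym x²≡2) (bil-zeroˡ H x x≈0))
    where
    2≢0 : + 2 / 1 ≢ 0ℚ
    2≢0 ()

  norm-2-in-M⇒norm-4-in-L3 : (∃ λ m → M m × bil H m m ≡ + 2 / 1) →
                              ∃ λ x → L3 M N x × NonZero₃ x × norm₃ H x ≡ + 4 / 1
  norm-2-in-M⇒norm-4-in-L3 (m , m∈M , m²≡2) =
    (m , -m , zeroV) ,
    ((m , -m , zeroV) , (zeroV , zeroV , zeroV) ,
     (m∈M , Span-· gM -[1+ 0 ] m∈M , Span-0 gM (λ _ → refl) , Span-0 gM m-m≈0 , Span-0 gN m-m≈0) ,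
     (zeroV , Span-0 gN (λ _ → refl) , (λ _ → refl) , (λ _ → refl) , (λ _ → refl)) ,
     (λ j → sym (ℚP.+-identityʳ (m j))) , (λ j → sym (ℚP.+-identityʳ (-m j))) , (λ _ → refl)) ,
    (λ (m≈0 , _) → norm-2⇒≉0 m²≡2 m≈0) ,
    norm
    where
    open ℚSolver.+-*-Solver
    -m : Vec 24
    -m = -[1+ 0 ] · m
    m-m≈0 : (m ⊕ (-m ⊕ zeroV)) ≈ zeroV
    m-m≈0 j = solve 1 (λ p → p :+ (con (-[1+ 0 ] / 1) :* p :+ con 0ℚ) := con 0ℚ) refl (m j)
    norm : bil H m m + (bil H -m -m + bil H zeroV zeroV) ≡ + 4 / 1
    norm = begin
      bil H m m + (bil H -m -m + bil H zeroV zeroV)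
        ≡⟨ cong₂ (λ u v → bil H m m + (u + v))
                 (trans (bil-·ˡ H -[1+ 0 ] m -m) (cong (_*_ (-[1+ 0 ] / 1)) (bil-·ʳ H -[1+ 0 ] m m)))
                 (bil-zeroˡ H zeroV (λ _ → refl)) ⟩
      bil H m m + ((-[1+ 0 ] / 1) * ((-[1+ 0 ] / 1) * bil H m m) + 0ℚ)
        ≡⟨ cong (λ t → t + ((-[1+ 0 ] / 1) * ((-[1+ 0 ] / 1) * t) + 0ℚ)) m²≡2 ⟩
      + 4 / 1
        ∎
      where open ≡-Reasoning

  norm-2-in-N⇒norm-6-in-L3 : (∃ λ n → N n × bil H n n ≡ + 2 / 1) →
                              ∃ λ x → L3 M N x × NonZero₃ x × norm₃ H x ≡ + 6 / 1
  norm-2-in-N⇒norm-6-in-L3 (n , n∈N , n²≡2) =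
    (n , n , n) ,
    ((zeroV , zeroV , zeroV) , (n , n , n) ,
     (Span-0 gM (λ _ → refl) , Span-0 gM (λ _ → refl) , Span-0 gM (λ _ → refl) ,
      Span-0 gM (λ _ → refl) , Span-0 gN (λ _ → refl)) ,
     (n , n∈N , (λ _ → refl) , (λ _ → refl) , (λ _ → refl)) ,
     0⊕n , 0⊕n , 0⊕n) ,
    (λ (n≈0 , _) → norm-2⇒≉0 n²≡2 n≈0) ,
    cong (λ t → t + (t + t)) n²≡2
    where
    0⊕n : n ≈ (zeroV ⊕ n)
    0⊕n j = sym (ℚP.+-identityˡ (n j))

corollary3p2 : (G : Gram 24) → Symmetric G →
    (kU kM kN : ℕ) (gU : Fin kU → Vec 24) (gM : Fin kM → Vec 24) (gN : Fin kN → Vec 24) →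
    IsNiemeier G (Span kU gU) →
    IsPolarization (half G) (Span kU gU) (Span kM gM) (Span kN gN) →
    IsNiemeier (half G) (Span kM gM) →
    IsNiemeier (half G) (Span kN gN) →
    MinGE (L3 (Span kM gM) (Span kN gN)) (norm₃ (half G)) (+ 4 / 1)
    × (¬ IsLeech (half G) (Span kM gM) →
         MinEq (L3 (Span kM gM) (Span kN gN)) (norm₃ (half G)) (+ 4 / 1))
    × (IsLeech G (Span kU gU) → IsLeech (half G) (Span kM gM) →
         MinGE (L3 (Span kM gM) (Span kN gN)) (norm₃ (half G)) (+ 6 / 1))
    × (IsLeech G (Span kU gU) → IsLeech (half G) (Span kM gM) →
       ¬ IsLeech (half G) (Span kN gN) →
         MinEq (L3 (Span kM gM) (Span kN gN)) (norm₃ (half G)) (+ 6 / 1))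
corollary3p2 G G-sym kU kM kN gU gM gN U-Niemeier pol M-Niemeier N-Niemeier =
    μ≥4
  , (λ M≇Λ → μ≥4 , norm-2-in-M⇒norm-4-in-L3 (NiemeierLattice.¬Leech⇒norm-2 H H-sym gM M-Niemeier M≇Λ))
  , μ≥6
  , (λ U≅Λ M≅Λ N≇Λ → μ≥6 U≅Λ M≅Λ , norm-2-in-N⇒norm-6-in-L3 (NiemeierLattice.¬Leech⇒norm-2 H H-sym gN N-Niemeier N≇Λ))
  where
  open Construction G G-sym gU gM gN pol M-Niemeier N-Niemeier

  μ≥4 : MinGE (L3 M N) (norm₃ H) (+ 4 / 1)
  μ≥4 = Bound.L3-MinGE (+ 4 / 1) (½ * fromℤ (+ 2)) (fromℤ (+ 2))
          (NormsAtLeast-half {G = G} {U} {fromℤ (+ 2)} (Niemeier-norms≥2 {G} {U} U-Niemeier))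
          (Niemeier-norms≥2 {H} {M} M-Niemeier)
          ℚP.≤-refl ℚP.≤-refl
          (λ K 3≤2K → fromℤ-mono-≤ {+ 4} (3≤2K⇒4≤2K K (fromℤ-cancel-≤ {+ 3} {+ 2 ℤ.* K} 3≤2K)))

  μ≥6 : IsLeech G U → IsLeech H M → MinGE (L3 M N) (norm₃ H) (+ 6 / 1)
  μ≥6 U≅Λ M≅Λ = Bound.L3-MinGE (+ 6 / 1) (½ * fromℤ (+ 4)) (fromℤ (+ 4))
          (NormsAtLeast-half {G = G} {U} {fromℤ (+ 4)} (Leech-norms≥4 {G} {U} U≅Λ))
          (Leech-norms≥4 {H} {M} M≅Λ)
          (fromℤ-mono-≤ {+ 6} {+ 8} (+≤+ (ℕP.m≤m+n 6 2)))
          (fromℤ-mono-≤ {+ 6} {+ 8} (+≤+ (ℕP.m≤m+n 6 2)))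
          (λ K 6≤2K → 6≤2K)
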